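{- Let $G$ be a finite graph and $k\geq 2$ an integer such that $G^{k-1}$ is an interval graph. Let $R=(I_x)_{x\in V(G)}$ be any interval representation of $G^{k-1}$. Then $R$ can be extended to an interval representation $R'=(I'_x)_{x\in V(G)}$ of $G^k$ (that is, $I_x\subseteq I'_x$ for every vertex $x$) such that $R$ and $R'$ induce the same left endpoint order and the same right endpoint order.
   Context: For a graph $G$ and integer $k\geq 1$, the $k$th power $G^k$ is the graph on $V(G)$ in which two distinct vertices are adjacent iff their distance in $G$ is at most $k$. An interval representation of a graph $H$ is a family $(I_x)_{x\in V(H)}$ of closed real intervals such that two distinct vertices $x,y$ are adjacent in $H$ iff $I_x\cap I_y\neq\emptyset$; $H$ is an interval graph if it has one. Writing $\ell(I)$ and $r(I)$ for the left and right endpoints of an interval $I$, the left endpoint order induced by a representation is the (pre)order $\leqslant_L$ on the vertices given by $x\leqslant_L y$ iff $\ell(I_x)\leq \ell(I_y)$, and the right endpoint order $\leqslant_R$ is given by $x\leqslant_R y$ iff $r(I_x)\leq r(I_y)$ (ties allowed). Two representations induce the same order if these relations coincide on all pairs of vertices.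
   Formalization: The intervals of the representation R have rational endpoints rather than real ones, and the intervals of the extension R' are likewise taken with rational endpoints. -}

module Defs where

open import Data.Nat using (ℕ; zero; suc; _≤_)
open import Data.Fin using (Fin)
open import Data.Product using (Σ; ∃; _×_; _,_)
open import Data.Rational using (ℚ) renaming (_≤_ to _≤ℚ_)
open import Relation.Binary.PropositionalEquality using (_≡_; _≢_)
open import Relation.Nullary using (¬_)
open import Function.Bundles using (_⇔_)

record Graph (n : ℕ) : Set₁ where
  field
    Adj   : Fin n → Fin n → Set
    sym   : ∀ {x y} → Adj x y → Adj y x
    irref : ∀ {x} → ¬ Adj x x
open Graph public

data Walk {n : ℕ} (G : Graph n) : ℕ → Fin n → Fin n → Set where
  here : ∀ {x} → Walk G zero x x
  step : ∀ {m x y z} → Adj G x y → Walk G m y z → Walk G (suc m) x z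

DistLe : ∀ {n} → Graph n → ℕ → Fin n → Fin n → Set
DistLe G k x y = ∃ λ m → m ≤ k × Walk G m x y

PowAdj : ∀ {n} → Graph n → ℕ → Fin n → Fin n → Set
PowAdj G k x y = x ≢ y × DistLe G k x y

record Interval : Set where
  constructor [_,_]⟨_⟩
  field
    l   : ℚ
    r   : ℚ
    l≤r : l ≤ℚ r
open Interval public

_∈I_ : ℚ → Interval → Set
q ∈I I = (l I ≤ℚ q) × (q ≤ℚ r I)

Meets : Interval → Interval → Set
Meets I J = ∃ λ q → q ∈I I × q ∈I J

_⊆I_ : Interval → Interval → Set
I ⊆I J = ∀ q → q ∈I I → q ∈I J

IsIntervalRep : ∀ {n} → (Fin n → Fin n → Set) → (Fin n → Interval) → Set
IsIntervalRep H R = ∀ x y → x ≢ y → (H x y ⇔ Meets (R x) (R y))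

SameLeftOrder : ∀ {n} → (Fin n → Interval) → (Fin n → Interval) → Set
SameLeftOrder R R' = ∀ x y → (l (R x) ≤ℚ l (R y)) ⇔ (l (R' x) ≤ℚ l (R' y))

SameRightOrder : ∀ {n} → (Fin n → Interval) → (Fin n → Interval) → Set
SameRightOrder R R' = ∀ x y → (r (R x) ≤ℚ r (R y)) ⇔ (r (R' x) ≤ℚ r (R' y))

{-# OPTIONS --safe #-}
module Submission where

-- Keep every left endpoint a x and push only right endpoints b x outwards.  Let z lie to the
-- right of I_x, i.e. b x < a z.  A walk of length at most k from x to z ends in the (k-1)-ball of
-- its first step y, so a z ≤ b y.  Conversely, if a neighbour y of x has a z ≤ b y, then I_y meets
-- I_z, so dist(x, z) ≤ k; and a walk of length at most k to z from any vertex whose right endpoint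
-- is at most b x can be rerouted through x, since the interval of its second-to-last vertex meets
-- I_x.  Hence, for a x ≤ a z, dist(x, z) ≤ k iff a z ≤ b⁺ x, where b⁺ x is the largest right
-- endpoint in the closed neighbourhoods of all y with b y ≤ b x; b⁺ is monotone in b.  Finally
-- b′ = b⁺ + δ (b - lo), for a lower bound lo of b and a small δ > 0, breaks the ties of b⁺ exactly
-- as b does without moving b⁺ x past any left endpoint.

open import Defs
open import Data.Nat using (ℕ; _≤_; _∸_; zero; suc; z≤n; s≤s)
open import Data.Nat.Properties using (m≤n⇒m≤1+n)
open import Data.Fin using (Fin)
open import Data.Fin.Properties using (_≟_)
open import Data.Product using (Σ; _×_; _,_; proj₁; proj₂; ∃-syntax; Σ-syntax)
open import Data.Sum using (inj₁; inj₂)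
open import Data.List using (List; tabulate; filter; allFin; cartesianProductWith)
open import Data.List.Membership.Propositional.Properties
  using (∈-allFin; ∈-filter⁺; ∈-cartesianProductWith⁺)
open import Data.List.Relation.Unary.All using (lookup)
import Data.List.Relation.Unary.All.Properties as All
open import Data.Rational
  using (ℚ; 0ℚ; 1ℚ; _+_; _*_; _-_; -_; _⊔_; 1/_; Positive; NonNegative; NonZero; positive)
  renaming (_≤_ to _≤ℚ_; _<_ to _<ℚ_)
open import Data.Rational.Properties
  using ( ≤-refl; ≤-trans; ≤-total; <⇒≤; ≤-<-trans; <-≤-trans; <-irrefl; ≮⇒≥; ≰⇒>; _≤?_; _<?_
        ; ≤-decTotalOrder; ⊔-lub; p≤p⊔q; p≤q⊔p; positive⁻¹; pos⇒nonZero; pos⇒nonNeg; 1/pos⇒pos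
        ; pos*pos⇒pos; +-monoʳ-≤; +-monoˡ-≤; +-monoʳ-<; +-monoˡ-<; +-mono-≤; +-mono-≤-<
        ; +-inverseʳ; +-identityʳ; *-zeroˡ; *-identityˡ; *-assoc; *-comm; *-inverseʳ
        ; *-monoʳ-≤-nonNeg; *-monoˡ-<-pos; module ≤-Reasoning )
open import Data.Rational.Solver using (module +-*-Solver)
open import Relation.Binary.Bundles using (DecTotalOrder)
open import Data.List.Extrema (DecTotalOrder.totalOrder ≤-decTotalOrder)
  using ( min; max; argmax; argmin-all; argmax-all; min≤⊤; min≤xs; ⊥≤max; xs≤max
        ; f[⊥]≤f[argmax]; f[xs]≤f[argmax] )
open import Function using (_∘_; id)
open import Function.Bundles using (_⇔_; mk⇔; Equivalence)
open import Relation.Binary.Construct.Closure.Reflexive using (ReflClosure; refl; [_])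
open import Relation.Binary.Construct.Closure.Reflexive.Properties
  using () renaming (sym to reflClosure-sym)
open import Relation.Binary.PropositionalEquality
  using (_≡_; refl; cong; subst; _≢_; ≢-sym; module ≡-Reasoning)
open import Relation.Nullary using (¬_; Dec; yes; no; contradiction)
open import Relation.Nullary.Decidable using (map′; _×-dec_)

private
  ≤⇒≯ : ∀ {p q} → p ≤ℚ q → ¬ (q <ℚ p)
  ≤⇒≯ p≤q q<p = <-irrefl refl (≤-<-trans p≤q q<p)

  0<1 : 0ℚ <ℚ 1ℚ
  0<1 = positive⁻¹ 1ℚ

  p≤q⇒0≤q-p : ∀ {p q} → p ≤ℚ q → 0ℚ ≤ℚ q - p
  p≤q⇒0≤q-p {p} {q} p≤q = subst (_≤ℚ q - p) (+-inverseʳ p) (+-monoˡ-≤ (- p) p≤q)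

  p<q⇒0<q-p : ∀ {p q} → p <ℚ q → 0ℚ <ℚ q - p
  p<q⇒0<q-p {p} {q} p<q = subst (_<ℚ q - p) (+-inverseʳ p) (+-monoˡ-< (- p) p<q)

  p<p+1 : ∀ p → p <ℚ p + 1ℚ
  p<p+1 p = subst (_<ℚ p + 1ℚ) (+-identityʳ p) (+-monoʳ-< p 0<1)

  p+[q-p]≡q : ∀ p q → p + (q - p) ≡ q
  p+[q-p]≡q = solve 2 (λ p q → p :+ (q :- p) := q) refl
    where open +-*-Solver

mono∧strictMono⇒≤⇔≤ : ∀ {A : Set} (f g : A → ℚ) →
  (∀ x y → f x ≤ℚ f y → g x ≤ℚ g y) → (∀ x y → f x <ℚ f y → g x <ℚ g y) →
  ∀ x y → f x ≤ℚ f y ⇔ g x ≤ℚ g y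
mono∧strictMono⇒≤⇔≤ f g mono strictMono x y =
  mk⇔ (mono x y) (λ gx≤gy → ≮⇒≥ (≤⇒≯ gx≤gy ∘ strictMono y x))

meets⇔ : ∀ I J → Meets I J ⇔ (l J ≤ℚ r I × l I ≤ℚ r J)
meets⇔ I J = mk⇔ to from
  where
  to : Meets I J → l J ≤ℚ r I × l I ≤ℚ r J
  to (q , (lI≤q , q≤rI) , (lJ≤q , q≤rJ)) = ≤-trans lJ≤q q≤rI , ≤-trans lI≤q q≤rJ

  from : l J ≤ℚ r I × l I ≤ℚ r J → Meets I J
  from (lJ≤rI , lI≤rJ) =
    l I ⊔ l J , (p≤p⊔q (l I) (l J) , ⊔-lub (l≤r I) lJ≤rI)
              , (p≤q⊔p (l I) (l J) , ⊔-lub lI≤rJ (l≤r J))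

meets? : ∀ I J → Dec (Meets I J)
meets? I J = map′ (Equivalence.from (meets⇔ I J)) (Equivalence.to (meets⇔ I J))
                  (l J ≤? r I ×-dec l I ≤? r J)

cut⇒isIntervalRep : ∀ {n} {H : Fin n → Fin n → Set} (a b : Fin n → ℚ)
  (a≤b : ∀ x → a x ≤ℚ b x) → (∀ {x z} → H x z → H z x) →
  (∀ x z → x ≢ z → a x ≤ℚ a z → H x z ⇔ a z ≤ℚ b x) →
  IsIntervalRep H (λ x → [ a x , b x ]⟨ a≤b x ⟩)
cut⇒isIntervalRep {H = H} a b a≤b H-sym cut x z x≢z = mk⇔ to from
  where
  I : Fin _ → Interval
  I x = [ a x , b x ]⟨ a≤b x ⟩

  to : H x z → Meets (I x) (I z)
  to h with ≤-total (a x) (a z)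
  ... | inj₁ ax≤az = Equivalence.from (meets⇔ (I x) (I z))
                       (Equivalence.to (cut x z x≢z ax≤az) h , ≤-trans ax≤az (a≤b z))
  ... | inj₂ az≤ax = Equivalence.from (meets⇔ (I x) (I z))
                       (≤-trans az≤ax (a≤b x) , Equivalence.to (cut z x (≢-sym x≢z) az≤ax) (H-sym h))

  from : Meets (I x) (I z) → H x z
  from m with Equivalence.to (meets⇔ (I x) (I z)) m | ≤-total (a x) (a z)
  ... | az≤bx , _ | inj₁ ax≤az = Equivalence.from (cut x z x≢z ax≤az) az≤bx
  ... | _ , ax≤bz | inj₂ az≤ax = H-sym (Equivalence.from (cut z x (≢-sym x≢z) az≤ax) ax≤bz)

module _ {n} {G : Graph n} where

  private
    variable
      m k : ℕ
      x y z : Fin n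

  snoc : Walk G m x y → Adj G y z → Walk G (suc m) x z
  snoc here       e = step e here
  snoc (step d w) e = step d (snoc w e)

  reverse : Walk G m x y → Walk G m y x
  reverse here       = here
  reverse (step e w) = snoc (reverse w) (sym G e)

  distLe-sym : DistLe G k x y → DistLe G k y x
  distLe-sym (m , m≤k , w) = m , m≤k , reverse w

  distLe-weaken : DistLe G k x y → DistLe G (suc k) x y
  distLe-weaken (m , m≤k , w) = m , m≤n⇒m≤1+n m≤k , w

  distLe-cons : ReflClosure (Adj G) x y → DistLe G k y z → DistLe G (suc k) x z
  distLe-cons refl  d             = distLe-weaken d
  distLe-cons [ e ] (m , m≤k , w) = suc m , s≤s m≤k , step e w

  distLe-snoc : DistLe G k x y → ReflClosure (Adj G) y z → DistLe G (suc k) x z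
  distLe-snoc d             refl  = distLe-weaken d
  distLe-snoc (m , m≤k , w) [ e ] = suc m , s≤s m≤k , snoc w e

  reflClosure⇒distLe : ReflClosure (Adj G) x y → DistLe G (suc k) x y
  reflClosure⇒distLe x~y = distLe-cons x~y (0 , z≤n , here)

  distLe-uncons : DistLe G (suc k) x z → ∃[ y ] ReflClosure (Adj G) x y × DistLe G k y z
  distLe-uncons (zero  , _       , here)     = _ , refl , (0 , z≤n , here)
  distLe-uncons (suc m , s≤s m≤k , step e w) = _ , [ e ] , (m , m≤k , w)

  distLe-unsnoc : DistLe G (suc k) x z → ∃[ y ] DistLe G k x y × ReflClosure (Adj G) y z
  distLe-unsnoc d =
    let y , z~y , y~x = distLe-uncons (distLe-sym d)
    in y , distLe-sym y~x , reflClosure-sym (sym G) z~y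

-- Only the statements of these two lemmas matter; unfolding their list extrema makes the
-- with-abstractions in perturb prohibitively slow.
opaque
  finite-bounds : ∀ {n} (f : Fin n → ℚ) →
    ∃[ lo ] ∃[ hi ] lo ≤ℚ hi × (∀ x → lo ≤ℚ f x × f x ≤ℚ hi)
  finite-bounds f = min 0ℚ fs , max 0ℚ fs , ≤-trans (min≤⊤ 0ℚ fs) (⊥≤max 0ℚ fs)
                  , λ x → All.tabulate⁻ (min≤xs 0ℚ fs) x , All.tabulate⁻ (xs≤max 0ℚ fs) x
    where
    fs : List ℚ
    fs = tabulate f

  finite-gap : ∀ {n m} (a : Fin n → ℚ) (b : Fin m → ℚ) →
    ∃[ ε ] 0ℚ <ℚ ε × (∀ x z → a x <ℚ b z → a x + ε ≤ℚ b z)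
  finite-gap {n} {m} a b = ε , 0<ε , a+ε≤b
    where
    differences gaps : List ℚ
    differences = cartesianProductWith (λ x z → b z - a x) (allFin n) (allFin m)
    gaps = filter (0ℚ <?_) differences

    ε : ℚ
    ε = min 1ℚ gaps

    0<ε : 0ℚ <ℚ ε
    0<ε = argmin-all id 0<1 (All.all-filter (0ℚ <?_) differences)

    a+ε≤b : ∀ x z → a x <ℚ b z → a x + ε ≤ℚ b z
    a+ε≤b x z ax<bz = begin
        a x + ε            ≤⟨ +-monoʳ-≤ (a x) ε≤gap ⟩
        a x + (b z - a x)  ≡⟨ p+[q-p]≡q (a x) (b z) ⟩
        b z                ∎
      where
      open ≤-Reasoning
      ε≤gap : ε ≤ℚ b z - a x
      ε≤gap = lookup (min≤xs 1ℚ gaps) (∈-filter⁺ (0ℚ <?_)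
        (∈-cartesianProductWith⁺ (λ x z → b z - a x) (∈-allFin x) (∈-allFin z)) (p<q⇒0<q-p ax<bz))

quotient : ∀ {w ε} → 0ℚ <ℚ w → 0ℚ <ℚ ε → ∃[ δ ] 0ℚ <ℚ δ × w * δ ≡ ε
quotient {w} {ε} 0<w 0<ε = ε * 1/ w , 0<δ , w*δ≡ε
  where
  instance
    w-pos : Positive w
    w-pos = positive 0<w
    w-nonZero : NonZero w
    w-nonZero = pos⇒nonZero w
    1/w-pos : Positive (1/ w)
    1/w-pos = 1/pos⇒pos w

    ε-pos : Positive ε
    ε-pos = positive 0<ε

  0<δ : 0ℚ <ℚ ε * 1/ w
  0<δ = positive⁻¹ _ {{pos*pos⇒pos ε (1/ w)}}

  w*δ≡ε : w * (ε * 1/ w) ≡ ε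
  w*δ≡ε = begin
    w * (ε * 1/ w)  ≡⟨ cong (w *_) (*-comm ε (1/ w)) ⟩
    w * (1/ w * ε)  ≡⟨ *-assoc w (1/ w) ε ⟨
    w * 1/ w * ε    ≡⟨ cong (_* ε) (*-inverseʳ w) ⟩
    1ℚ * ε          ≡⟨ *-identityˡ ε ⟩
    ε               ∎
    where open ≡-Reasoning

squeeze : ∀ {n} (f : Fin n → ℚ) {lo hi ε} →
  lo ≤ℚ hi → (∀ x → lo ≤ℚ f x × f x ≤ℚ hi) → 0ℚ <ℚ ε →
  Σ[ c ∈ (Fin n → ℚ) ] (∀ x → 0ℚ ≤ℚ c x × c x <ℚ ε)
                     × (∀ x y → f x ≤ℚ f y → c x ≤ℚ c y)
                     × (∀ x y → f x <ℚ f y → c x <ℚ c y)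
squeeze {n} f {lo} {hi} {ε} lo≤hi f-bounds 0<ε
  with quotient (≤-<-trans (p≤q⇒0≤q-p lo≤hi) (p<p+1 (hi - lo))) 0<ε
... | δ , 0<δ , width*δ≡ε = c , c-bounds , c-mono , c-strictMono
  where
  instance
    δ-pos : Positive δ
    δ-pos = positive 0<δ
    δ-nonNeg : NonNegative δ
    δ-nonNeg = pos⇒nonNeg δ

  c : Fin n → ℚ
  c x = (f x - lo) * δ

  c-bounds : ∀ x → 0ℚ ≤ℚ c x × c x <ℚ ε
  c-bounds x = subst (_≤ℚ c x) (*-zeroˡ δ) (*-monoʳ-≤-nonNeg δ (p≤q⇒0≤q-p (proj₁ (f-bounds x))))
             , subst (c x <ℚ_) width*δ≡ε (*-monoˡ-<-pos δ
                 (≤-<-trans (+-monoˡ-≤ (- lo) (proj₂ (f-bounds x))) (p<p+1 (hi - lo))))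

  c-mono : ∀ x y → f x ≤ℚ f y → c x ≤ℚ c y
  c-mono x y fx≤fy = *-monoʳ-≤-nonNeg δ (+-monoˡ-≤ (- lo) fx≤fy)

  c-strictMono : ∀ x y → f x <ℚ f y → c x <ℚ c y
  c-strictMono x y fx<fy = *-monoˡ-<-pos δ (+-monoˡ-< (- lo) fx<fy)

record Perturbation {n m} (f T : Fin n → ℚ) (L : Fin m → ℚ) : Set where
  field
    T′        : Fin n → ℚ
    T≤T′      : ∀ x → T x ≤ℚ T′ x
    T′-like-f : ∀ x y → f x ≤ℚ f y ⇔ T′ x ≤ℚ T′ y
    ≤T′⇒≤T    : ∀ x z → L z ≤ℚ T′ x → L z ≤ℚ T x

perturb : ∀ {n m} (f T : Fin n → ℚ) (L : Fin m → ℚ) →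
  (∀ x y → f x ≤ℚ f y → T x ≤ℚ T y) → Perturbation f T L
perturb {n} f T L T-mono with finite-gap T L | finite-bounds f
... | ε , 0<ε , gap | _ , _ , lo≤hi , f-bounds with squeeze f lo≤hi f-bounds 0<ε
... | c , c-bounds , c-mono , c-strictMono = record
  { T′        = T′
  ; T≤T′      = λ x → subst (_≤ℚ T′ x) (+-identityʳ (T x)) (+-monoʳ-≤ (T x) (proj₁ (c-bounds x)))
  ; T′-like-f = mono∧strictMono⇒≤⇔≤ f T′
      (λ x y fx≤fy → +-mono-≤ (T-mono x y fx≤fy) (c-mono x y fx≤fy))
      (λ x y fx<fy → +-mono-≤-< (T-mono x y (<⇒≤ fx<fy)) (c-strictMono x y fx<fy))
  ; ≤T′⇒≤T    = λ x z Lz≤T′x → ≮⇒≥ λ Tx<Lz →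
      ≤⇒≯ Lz≤T′x (<-≤-trans (+-monoʳ-< (T x) (proj₂ (c-bounds x))) (gap x z Tx<Lz))
  }
  where
  T′ : Fin n → ℚ
  T′ x = T x + c x

module Extension {n} (G : Graph n) (j : ℕ) (R : Fin n → Interval)
                 (R-rep : IsIntervalRep (PowAdj G (suc j)) R) where

  private
    variable
      x y z : Fin n

  a b : Fin n → ℚ
  a x = l (R x)
  b x = r (R x)

  meets⇒distLe : Meets (R x) (R y) → DistLe G (suc j) x y
  meets⇒distLe {x} {y} m with x ≟ y
  ... | yes refl = 0 , z≤n , here
  ... | no x≢y   = proj₂ (Equivalence.from (R-rep x y x≢y) m)

  distLe⇒meets : DistLe G (suc j) x y → Meets (R x) (R y)
  distLe⇒meets {x} {y} d with x ≟ y
  ... | yes refl = Equivalence.from (meets⇔ (R x) (R x)) (l≤r (R x) , l≤r (R x))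
  ... | no x≢y   = Equivalence.to (R-rep x y x≢y) (x≢y , d)

  distLe⇒a≤b : DistLe G (suc j) x y → a y ≤ℚ b x
  distLe⇒a≤b {x} {y} d = proj₁ (Equivalence.to (meets⇔ (R x) (R y)) (distLe⇒meets d))

  overlap⇒distLe : a y ≤ℚ b x → a x ≤ℚ b y → DistLe G (suc j) x y
  overlap⇒distLe {y} {x} ay≤bx ax≤by =
    meets⇒distLe (Equivalence.from (meets⇔ (R x) (R y)) (ay≤bx , ax≤by))

  -- Adjacency is not decidable, so instead of maximising over all neighbours of x we maximise over
  -- the first steps of walks to the vertices t of the (k-1)-ball of x, which R lets us decide.
  towards : ∀ x t → ∃[ y ] ReflClosure (Adj G) x y × (Meets (R x) (R t) → DistLe G j y t)
  towards x t with meets? (R x) (R t)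
  ... | yes m  = let y , x~y , y~t = distLe-uncons (meets⇒distLe m) in y , x~y , λ _ → y~t
  ... | no ¬m  = x , refl , λ m → contradiction m ¬m

  first-steps : Fin n → List (Fin n)
  first-steps x = tabulate (λ t → proj₁ (towards x t))

  reach : Fin n → Fin n
  reach x = argmax b x (first-steps x)

  reach-adj : ∀ x → ReflClosure (Adj G) x (reach x)
  reach-adj x = argmax-all b {P = ReflClosure (Adj G) x} refl
                  (All.tabulate⁺ (λ t → proj₁ (proj₂ (towards x t))))

  b≤b∘reach : ∀ x → b x ≤ℚ b (reach x)
  b≤b∘reach x = f[⊥]≤f[argmax] {f = b} x (first-steps x)

  towards≤reach : ∀ x t → b (proj₁ (towards x t)) ≤ℚ b (reach x)
  towards≤reach x t = All.tabulate⁻ (f[xs]≤f[argmax] {f = b} x (first-steps x)) t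

  distLe⇒a≤b∘reach : DistLe G (suc (suc j)) x z → a z ≤ℚ b (reach x)
  distLe⇒a≤b∘reach {x} d =
    let p , x~p , p~z = distLe-unsnoc d
        y , _ , y~p   = towards x p
    in ≤-trans (distLe⇒a≤b (distLe-snoc (y~p (distLe⇒meets x~p)) p~z)) (towards≤reach x p)

  a≤b∘reach⇒distLe : b x <ℚ a z → a z ≤ℚ b (reach x) → DistLe G (suc (suc j)) x z
  a≤b∘reach⇒distLe {x} {z} bx<az az≤bw = distLe-cons (reach-adj x) (overlap⇒distLe az≤bw aw≤bz)
    where
    aw≤bz : a (reach x) ≤ℚ b z
    aw≤bz = <⇒≤ (≤-<-trans (distLe⇒a≤b (reflClosure⇒distLe (reach-adj x)))
                           (<-≤-trans bx<az (l≤r (R z))))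

  distLe-transfer : b y ≤ℚ b x → b x <ℚ a z →
                    DistLe G (suc (suc j)) y z → DistLe G (suc (suc j)) x z
  distLe-transfer {y} {x} {z} by≤bx bx<az d =
    let p , y~p , p~z = distLe-unsnoc d
        az≤bp = distLe⇒a≤b (reflClosure⇒distLe p~z)
        ax≤bp = ≤-trans (l≤r (R x)) (<⇒≤ (<-≤-trans bx<az az≤bp))
    in distLe-snoc (overlap⇒distLe (≤-trans (distLe⇒a≤b y~p) by≤bx) ax≤bp) p~z

  behind : Fin n → List (Fin n)
  behind x = filter (λ y → b y ≤? b x) (allFin n)

  ahead : Fin n → Fin n
  ahead x = argmax (b ∘ reach) x (behind x)

  b∘ahead≤b : ∀ x → b (ahead x) ≤ℚ b x
  b∘ahead≤b x = argmax-all (b ∘ reach) {P = λ y → b y ≤ℚ b x} ≤-refl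
                  (All.all-filter (λ y → b y ≤? b x) (allFin n))

  b⁺ : Fin n → ℚ
  b⁺ x = b (reach (ahead x))

  b∘reach≤b⁺ : b y ≤ℚ b x → b (reach y) ≤ℚ b⁺ x
  b∘reach≤b⁺ {y} {x} by≤bx =
    lookup (f[xs]≤f[argmax] {f = b ∘ reach} x (behind x))
           (∈-filter⁺ (λ y → b y ≤? b x) (∈-allFin y) by≤bx)

  b⁺-mono : ∀ x y → b x ≤ℚ b y → b⁺ x ≤ℚ b⁺ y
  b⁺-mono x y bx≤by = b∘reach≤b⁺ (≤-trans (b∘ahead≤b x) bx≤by)

  b≤b⁺ : ∀ x → b x ≤ℚ b⁺ x
  b≤b⁺ x = ≤-trans (b≤b∘reach x) (b∘reach≤b⁺ {x} {x} ≤-refl)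

  distLe⇔a≤b⁺ : a x ≤ℚ a z → DistLe G (suc (suc j)) x z ⇔ a z ≤ℚ b⁺ x
  distLe⇔a≤b⁺ {x} {z} ax≤az =
    mk⇔ (λ d → ≤-trans (distLe⇒a≤b∘reach d) (b∘reach≤b⁺ {x} {x} ≤-refl))
        (λ az≤b⁺x → by-cases az≤b⁺x (a z ≤? b x))
    where
    by-cases : a z ≤ℚ b⁺ x → Dec (a z ≤ℚ b x) → DistLe G (suc (suc j)) x z
    by-cases _ (yes az≤bx) =
      distLe-weaken (overlap⇒distLe {z} {x} az≤bx (≤-trans ax≤az (l≤r (R z))))
    by-cases az≤b⁺x (no az≰bx)  = distLe-transfer {ahead x} {x} {z} (b∘ahead≤b x) bx<az
      (a≤b∘reach⇒distLe {ahead x} {z} (≤-<-trans (b∘ahead≤b x) bx<az) az≤b⁺x)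
      where
      bx<az : b x <ℚ a z
      bx<az = ≰⇒> az≰bx

  open Perturbation (perturb b b⁺ a b⁺-mono) renaming (T′ to b′; T≤T′ to b⁺≤b′)

  b≤b′ : ∀ x → b x ≤ℚ b′ x
  b≤b′ x = ≤-trans (b≤b⁺ x) (b⁺≤b′ x)

  a≤b′ : ∀ x → a x ≤ℚ b′ x
  a≤b′ x = ≤-trans (l≤r (R x)) (b≤b′ x)

  R′ : Fin n → Interval
  R′ x = [ a x , b′ x ]⟨ a≤b′ x ⟩

  R′-rep : IsIntervalRep (PowAdj G (suc (suc j))) R′
  R′-rep = cut⇒isIntervalRep a b′ a≤b′ (λ (x≢z , d) → ≢-sym x≢z , distLe-sym d) cut
    where
    cut : ∀ x z → x ≢ z → a x ≤ℚ a z → PowAdj G (suc (suc j)) x z ⇔ a z ≤ℚ b′ x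
    cut x z x≢z ax≤az = mk⇔
      (λ (_ , d) → ≤-trans (Equivalence.to (distLe⇔a≤b⁺ ax≤az) d) (b⁺≤b′ x))
      (λ az≤b′x → x≢z , Equivalence.from (distLe⇔a≤b⁺ ax≤az) (≤T′⇒≤T x z az≤b′x))

  R⊆R′ : ∀ x → R x ⊆I R′ x
  R⊆R′ x q (ax≤q , q≤bx) = ax≤q , ≤-trans q≤bx (b≤b′ x)

  same-left : SameLeftOrder R R′
  same-left x y = mk⇔ id id

  same-right : SameRightOrder R R′
  same-right = T′-like-f

theorem1 : (n : ℕ) (G : Graph n) (k : ℕ) → 2 ≤ k →
    (R : Fin n → Interval) → IsIntervalRep (PowAdj G (k ∸ 1)) R →
    Σ (Fin n → Interval) λ R' →
      IsIntervalRep (PowAdj G k) R' ×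
      (∀ x → R x ⊆I R' x) ×
      SameLeftOrder R R' × SameRightOrder R R'
theorem1 n G (suc (suc j)) (s≤s (s≤s z≤n)) R R-rep = R′ , R′-rep , R⊆R′ , same-left , same-right
  where open Extension G j R R-rep
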